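{- Let $n\ge1$ and $m>2^n$ be integers, and consider a play of the game described in the context in which Kronecker uses the ``0 first'' strategy and Cantor queries all $mn$ entries in an arbitrary (adaptive) order; let $L_t$ be the state matrix after $t$ queries. If row $L_t(i)$ is not essential for $L_t$, then $L_t(i)$ contains no $1$ (its entries are all $0$ or $\star$). In particular, if $L_{mn}(i)$ is not essential for $L_{mn}$, then $L_{mn}(i)=0^n$. Hence every row of $L_{mn}$ that is not the zero vector is essential for $L_{mn}$, and thus differs from all other rows of $L_{mn}$.
   Context: Kronecker holds $v_1,\ldots,v_m\in\{0,1\}^n$; Cantor queries entries ``bit $j$ of vector $i$''. The state is an $m\times n$ matrix $L$ over $\{0,1,\star\}$, where $L(i,j)=\star$ means bit $j$ of $v_i$ is not yet queried and otherwise it is Kronecker's answer; $L_0$ is all $\star$, each query is to a $\star$ entry, and $L(i)$ denotes row $i$. A set $S$ of $2^n$ rows of $L$ is useful if, after replacing each $\star$ in $S$ by $0$ or $1$ suitably, the rows of $S$ are exactly the $2^n$ distinct vectors of $\{0,1\}^n$. $L$ is unblocked if it has a useful set of rows, and blocked otherwise. For an unblocked $L$, row $L(i)$ is essential for $L$ if every useful set of rows of $L$ contains $L(i)$. The ``0 first'' strategy: when entry $(i,j)$ is queried, Kronecker answers $1$ if setting $L(i,j)$ to $0$ would make $L$ blocked, and $0$ otherwise. -}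

module Defs where

open import Data.Nat using (ℕ)
open import Data.Unit using (⊤)
open import Data.Fin using (Fin; _≟_)
open import Data.Bool using (Bool; true; false)
open import Data.Vec using (Vec; lookup)
open import Data.Product using (Σ; ∃; _×_; _,_)
open import Relation.Nullary using (¬_; yes; no)
open import Relation.Binary.PropositionalEquality using (_≡_)
open import Function.Definitions using (Injective)

-- An entry of the state matrix: either a queried bit, or ⋆ (not yet queried).
data Cell : Set where
  ⋆   : Cell
  bit : Bool → Cell

Matrix : ℕ → ℕ → Set
Matrix m n = Fin m → Fin n → Cell

L₀ : ∀ {m n} → Matrix m n
L₀ _ _ = ⋆

set : ∀ {m n} → Matrix m n → Fin m → Fin n → Cell → Matrix m n
set L i j c i' j' with i' ≟ i | j' ≟ j
... | yes _ | yes _ = c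
... | _     | _     = L i' j'

Fits : Cell → Bool → Set
Fits ⋆       _ = ⊤
Fits (bit a) b = a ≡ b

-- A useful set of 2^n rows, given together with the suitable filling of its ⋆'s:
-- an injective assignment  S : {0,1}^n → Fin m  (its image is a set of exactly 2^n rows)
-- such that row S v, with ⋆'s replaced suitably, is the vector v.  Hence the filled
-- rows of the image are exactly the 2^n distinct vectors of {0,1}^n.
Useful : ∀ {m n} → Matrix m n → (Vec Bool n → Fin m) → Set
Useful {m} {n} L S =
  Injective _≡_ _≡_ S × (∀ (v : Vec Bool n) (j : Fin n) → Fits (L (S v) j) (lookup v j))

Unblocked : ∀ {m n} → Matrix m n → Set
Unblocked {m} {n} L = Σ (Vec Bool n → Fin m) (Useful L)

Blocked : ∀ {m n} → Matrix m n → Set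
Blocked L = ¬ Unblocked L

Essential : ∀ {m n} → Matrix m n → Fin m → Set
Essential {m} {n} L i =
  Unblocked L × (∀ (S : Vec Bool n → Fin m) → Useful L S → ∃ λ v → S v ≡ i)

data ZeroFirstStep {m n} (L : Matrix m n) : Matrix m n → Set where
  answer1 : ∀ i j → L i j ≡ ⋆ → Blocked (set L i j (bit false)) →
            ZeroFirstStep L (set L i j (bit true))
  answer0 : ∀ i j → L i j ≡ ⋆ → ¬ Blocked (set L i j (bit false)) →
            ZeroFirstStep L (set L i j (bit false))

-- The states L_t occurring in some play (any adaptive query order of Cantor)
-- against the "0 first" strategy.
data Reachable {m n} : Matrix m n → Set where
  start : Reachable L₀
  step  : ∀ {L L'} → Reachable L → ZeroFirstStep L L' → Reachable L'

Full : ∀ {m n} → Matrix m n → Set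
Full L = ∀ i j → ¬ (L i j ≡ ⋆)

-- Along every play against "0 first" two things stay true: L is not blocked, and every row
-- containing a 1 belongs to every useful set.  A 1 is written at (i , j) only when a 0 there
-- would block; since a useful set avoiding row i survives any change of row i, every useful
-- set of the new state must contain row i.  Answering a query only refines the matrix, which
-- can only shrink the family of useful sets, so old rows with a 1 stay covered.  When L is
-- full, unblockedness is decidable, so "not blocked" yields a useful set.  A row duplicating an
-- essential row i of a full matrix is not in that set (full rows determine their vectors), so
-- it could replace row i there, contradicting essentiality.

module Submission where

open import Defs
open import Data.Nat using (ℕ; _≤_; _<_; _^_; zero; suc)
open import Data.Nat.Properties using (<⇒≤)
open import Data.Fin as Fin using (Fin; combine; inject≤) renaming (_≟_ to _≟ᶠ_)
open import Data.Fin.Properties using (any?; all?; ¬∀⟶∃¬; 2↔Bool; combine-injective; inject≤-injective)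
open import Data.Bool using (Bool; true; false; not)
open import Data.Bool.Properties using () renaming (_≟_ to _≟ᵇ_)
open import Data.Vec using (Vec; []; _∷_; lookup)
open import Data.Vec.Properties using (≡-dec)
open import Data.Vec.Relation.Binary.Pointwise.Extensional using (ext; Pointwise-≡⇒≡)
open import Data.Product using (∃; _×_; _,_; proj₁; proj₂)
open import Data.Sum using (_⊎_; inj₁; inj₂; [_,_])
open import Data.Unit using (tt)
open import Data.Empty using (⊥-elim)
open import Function using (_∘_)
open import Function.Bundles using (Injection; _↣_)
open import Function.Properties.Inverse using (↔⇒↣)
open import Function.Construct.Symmetry using (↔-sym)
open import Function.Definitions using (Injective)
open import Relation.Nullary using (¬_; Dec; yes; no)
open import Relation.Nullary.Decidable using (map′; _⊎-dec_; decidable-stable)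
open import Relation.Unary using (Decidable)
open import Relation.Binary.PropositionalEquality using (_≡_; _≢_; refl; sym; trans; cong; cong₂; subst; module ≡-Reasoning)

open ≡-Reasoning

private
  variable
    m n : ℕ

bit-injective : ∀ {a b} → bit a ≡ bit b → a ≡ b
bit-injective refl = refl

_≟ᶜ_ : (c d : Cell) → Dec (c ≡ d)
⋆     ≟ᶜ ⋆     = yes refl
⋆     ≟ᶜ bit _ = no λ ()
bit _ ≟ᶜ ⋆     = no λ ()
bit a ≟ᶜ bit b = map′ (cong bit) bit-injective (a ≟ᵇ b)

known-fits : ∀ {c b} → c ≢ ⋆ → Fits c b → c ≡ bit b
known-fits {⋆}     c≢⋆ _ = ⊥-elim (c≢⋆ refl)
known-fits {bit _} _   refl = refl

known-not-flip : ∀ {c} b → c ≢ ⋆ → c ≢ bit (not b) → c ≡ bit b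
known-not-flip {⋆}         _     c≢⋆ _ = ⊥-elim (c≢⋆ refl)
known-not-flip {bit false} false _   _ = refl
known-not-flip {bit true}  true  _   _ = refl
known-not-flip {bit false} true  _   c≢0 = ⊥-elim (c≢0 refl)
known-not-flip {bit true}  false _   c≢1 = ⊥-elim (c≢1 refl)

set-origin : ∀ (L : Matrix m n) i j c {d} i′ j′ → set L i j c i′ j′ ≡ d →
             (i′ ≡ i × c ≡ d) ⊎ L i′ j′ ≡ d
set-origin L i j c i′ j′ e with i′ ≟ᶠ i | j′ ≟ᶠ j
... | yes i′≡i | yes _ = inj₁ (i′≡i , e)
... | yes _    | no _  = inj₂ e
... | no _     | _     = inj₂ e

anyBoolVec? : {P : Vec Bool n → Set} → Decidable P → Dec (∃ P)
anyBoolVec? {zero}  P? = map′ ([] ,_) (λ { ([] , p) → p }) (P? [])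
anyBoolVec? {suc n} P? =
  map′ [ (λ { (v , p) → false ∷ v , p }) , (λ { (v , p) → true ∷ v , p }) ]
       (λ { (false ∷ v , p) → inj₁ (v , p) ; (true ∷ v , p) → inj₂ (v , p) })
       (anyBoolVec? (P? ∘ (false ∷_)) ⊎-dec anyBoolVec? (P? ∘ (true ∷_)))

bool↣fin2 : Bool ↣ Fin 2
bool↣fin2 = ↔⇒↣ (↔-sym 2↔Bool)

open Injection bool↣fin2 using () renaming (to to fromBool; injective to fromBool-injective)

toFin : Vec Bool n → Fin (2 ^ n)
toFin []      = Fin.zero
toFin (b ∷ v) = combine (fromBool b) (toFin v)

toFin-injective : Injective _≡_ _≡_ (toFin {n})
toFin-injective {x = []}    {[]}    _ = refl
toFin-injective {x = a ∷ v} {b ∷ w} e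
  with a≈b , v≈w ← combine-injective (fromBool a) (toFin v) (fromBool b) (toFin w) e
  = cong₂ _∷_ (fromBool-injective a≈b) (toFin-injective v≈w)

EveryUsefulSetContains : Matrix m n → Fin m → Set
EveryUsefulSetContains {m} {n} L i = ∀ (S : Vec Bool n → Fin m) → Useful L S → ∃ λ v → S v ≡ i

_Refines_ : Matrix m n → Matrix m n → Set
L′ Refines L = ∀ i j {b} → Fits (L′ i j) b → Fits (L i j) b

useful-refine : ∀ {L L′ : Matrix m n} {S} → L′ Refines L → Useful L′ S → Useful L S
useful-refine L′⊑L (S-inj , fits) = S-inj , λ v j → L′⊑L _ j (fits v j)

covered-refine : ∀ {L L′ : Matrix m n} {i} → L′ Refines L →
                 EveryUsefulSetContains L i → EveryUsefulSetContains L′ i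
covered-refine L′⊑L covered S = covered S ∘ useful-refine L′⊑L

query-refines : ∀ {L : Matrix m n} {i j} c → L i j ≡ ⋆ → set L i j c Refines L
query-refines {L = L} {i} {j} c L≡⋆ i′ j′ with i′ ≟ᶠ i | j′ ≟ᶠ j
... | yes refl | yes refl rewrite L≡⋆ = λ _ → tt
... | yes _    | no _  = λ fits → fits
... | no _     | _     = λ fits → fits

useful-set : ∀ {L : Matrix m n} {S} i j c → Useful L S →
             (∀ v → S v ≡ i → Fits c (lookup v j)) → Useful (set L i j c) S
useful-set {L = L} {S} i j c (S-inj , fits) c-fits = S-inj , fits′
  where
  fits′ : ∀ v j′ → Fits (set L i j c (S v) j′) (lookup v j′)
  fits′ v j′ with S v ≟ᶠ i | j′ ≟ᶠ j
  ... | yes Sv≡i | yes refl = c-fits v Sv≡i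
  ... | yes _    | no _     = fits v j′
  ... | no _     | _        = fits v j′

L₀-unblocked : 2 ^ n ≤ m → Unblocked (L₀ {m} {n})
L₀-unblocked 2ⁿ≤m =
  (λ v → inject≤ (toFin v) 2ⁿ≤m) ,
  (λ e → toFin-injective (inject≤-injective 2ⁿ≤m 2ⁿ≤m _ _ e)) ,
  λ _ _ → tt

answer1-keeps-useful : ∀ {L : Matrix m n} {i j S} → Blocked (set L i j (bit false)) →
                       Useful L S → Useful (set L i j (bit true)) S
answer1-keeps-useful {i = i} {j} {S} blocked u@(S-inj , _) = useful-set i j (bit true) u row-has-1
  where
  row-has-1 : ∀ v → S v ≡ i → true ≡ lookup v j
  row-has-1 v Sv≡i with lookup v j in vⱼ≡b
  ... | true  = refl
  ... | false = ⊥-elim (blocked (S , useful-set i j (bit false) u row-has-0))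
    where
    row-has-0 : ∀ w → S w ≡ i → false ≡ lookup w j
    row-has-0 w Sw≡i with refl ← S-inj (trans Sw≡i (sym Sv≡i)) = sym vⱼ≡b

answer1-covers-row : ∀ {L : Matrix m n} {i j} → L i j ≡ ⋆ → Blocked (set L i j (bit false)) →
                     EveryUsefulSetContains (set L i j (bit true)) i
answer1-covers-row {i = i} {j} L≡⋆ blocked S u =
  decidable-stable (anyBoolVec? (λ v → S v ≟ᶠ i)) λ misses →
    blocked (S , useful-set i j (bit false) (useful-refine (query-refines (bit true) L≡⋆) u)
                   (λ v Sv≡i → ⊥-elim (misses (v , Sv≡i))))

record ZeroFirstInvariant (L : Matrix m n) : Set where
  field
    not-blocked         : ¬ Blocked L
    rows-with-1-covered : ∀ i j → L i j ≡ bit true → EveryUsefulSetContains L i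
open ZeroFirstInvariant

zero-first-step-invariant : ∀ {L L′ : Matrix m n} → ZeroFirstInvariant L → ZeroFirstStep L L′ →
                            ZeroFirstInvariant L′
zero-first-step-invariant {L = L} I (answer1 i j L≡⋆ blocked) = record
  { not-blocked         = λ blocked′ →
      not-blocked I λ (S , u) → blocked′ (S , answer1-keeps-useful blocked u)
  ; rows-with-1-covered = λ i′ j′ e → covered i′ (set-origin L i j _ i′ j′ e)
  }
  where
  covered : ∀ i′ {j′} → (i′ ≡ i × bit true ≡ bit true) ⊎ L i′ j′ ≡ bit true →
            EveryUsefulSetContains (set L i j (bit true)) i′
  covered i′ (inj₁ (refl , _)) = answer1-covers-row L≡⋆ blocked
  covered i′ (inj₂ e)          = covered-refine (query-refines _ L≡⋆) (rows-with-1-covered I i′ _ e)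
zero-first-step-invariant {L = L} I (answer0 i j L≡⋆ unblocked) = record
  { not-blocked         = unblocked
  ; rows-with-1-covered = λ i′ j′ e → covered i′ (set-origin L i j _ i′ j′ e)
  }
  where
  covered : ∀ i′ {j′} → (i′ ≡ i × bit false ≡ bit true) ⊎ L i′ j′ ≡ bit true →
            EveryUsefulSetContains (set L i j (bit false)) i′
  covered i′ (inj₂ e) = covered-refine (query-refines _ L≡⋆) (rows-with-1-covered I i′ _ e)

reachable-invariant : ∀ {L : Matrix m n} → 2 ^ n ≤ m → Reachable L → ZeroFirstInvariant L
reachable-invariant 2ⁿ≤m start = record
  { not-blocked = λ blocked → blocked (L₀-unblocked 2ⁿ≤m) ; rows-with-1-covered = λ _ _ () }
reachable-invariant 2ⁿ≤m (step r s) = zero-first-step-invariant (reachable-invariant 2ⁿ≤m r) s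

_≟ᵛ_ : (v w : Vec Bool n) → Dec (v ≡ w)
_≟ᵛ_ = ≡-dec _≟ᵇ_

row-reads-injective : ∀ {L : Matrix m n} {k v w} → (∀ j → L k j ≡ bit (lookup v j)) →
                      (∀ j → L k j ≡ bit (lookup w j)) → v ≡ w
row-reads-injective reads-v reads-w =
  Pointwise-≡⇒≡ (ext λ j → bit-injective (trans (sym (reads-v j)) (reads-w j)))

full-useful-row : ∀ {L : Matrix m n} {S} → Full L → Useful L S → ∀ v j → L (S v) j ≡ bit (lookup v j)
full-useful-row full (_ , fits) v j = known-fits (full _ j) (fits v j)

full-unblocked : ∀ {L : Matrix m n} → Full L → ¬ Blocked L → Unblocked L
full-unblocked {m} {n} {L} full unblocked =
  S , S-injective , λ v j → subst (λ c → Fits c (lookup v j)) (sym (reads v j)) refl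
  where
  Reads : Vec Bool n → Fin m → Set
  Reads v k = ∀ j → L k j ≡ bit (lookup v j)
  rowReading : ∀ v → ∃ (Reads v)
  rowReading v = decidable-stable (any? λ k → all? λ j → L k j ≟ᶜ bit (lookup v j))
    λ ¬reads → unblocked λ (S , u) → ¬reads (S v , full-useful-row full u v)
  S : Vec Bool n → Fin m
  S = proj₁ ∘ rowReading
  reads : ∀ v → Reads v (S v)
  reads = proj₂ ∘ rowReading
  S-injective : Injective _≡_ _≡_ S
  S-injective {v} {w} Sv≡Sw =
    row-reads-injective {L = L} (reads v) (subst (Reads w) (sym Sv≡Sw) (reads w))

redirect : (Vec Bool n → Fin m) → Vec Bool n → Fin m → Vec Bool n → Fin m
redirect S v k w with w ≟ᵛ v
... | yes _ = k
... | no _  = S w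

useful-redirect : ∀ {L : Matrix m n} {S v k} → Useful L S → (∀ j → L k j ≡ L (S v) j) →
                  (∀ w → S w ≢ k) → Useful L (redirect S v k)
useful-redirect {L = L} {S} {v} {k} (S-inj , fits) same-row k∉S = injective , fits′
  where
  injective : Injective _≡_ _≡_ (redirect S v k)
  injective {a} {b} e with a ≟ᵛ v | b ≟ᵛ v
  ... | yes a≡v | yes b≡v = trans a≡v (sym b≡v)
  ... | yes _   | no _    = ⊥-elim (k∉S b (sym e))
  ... | no _    | yes _   = ⊥-elim (k∉S a e)
  ... | no _    | no _    = S-inj e
  fits′ : ∀ w j → Fits (L (redirect S v k w) j) (lookup w j)
  fits′ w j with w ≟ᵛ v
  ... | yes refl rewrite same-row j = fits v j
  ... | no _ = fits w j

redirect-avoids : ∀ {S : Vec Bool n → Fin m} {v k i} → Injective _≡_ _≡_ S → S v ≡ i → k ≢ i →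
                  ∀ w → redirect S v k w ≢ i
redirect-avoids {v = v} S-inj Sv≡i k≢i w with w ≟ᵛ v
... | yes _   = k≢i
... | no w≢v  = λ Sw≡i → w≢v (S-inj (trans Sw≡i (sym Sv≡i)))

essential-row-not-duplicated : ∀ {L : Matrix m n} {i k} → Full L → Essential L i → k ≢ i →
                               ¬ (∀ j → L k j ≡ L i j)
essential-row-not-duplicated {L = L} {i} {k} full ((S , u) , covered) k≢i same
  with v , Sv≡i ← covered S u
  with anyBoolVec? (λ w → S w ≟ᶠ k)
... | yes (w , Sw≡k) = k≢i (trans (sym Sw≡k) (trans (cong S w≡v) Sv≡i))
  where
  w≡v : w ≡ v
  w≡v = row-reads-injective {L = L} (full-useful-row full u w) λ j → begin
    L (S w) j        ≡⟨ cong (λ x → L x j) Sw≡k ⟩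
    L k j            ≡⟨ same j ⟩
    L i j            ≡⟨ cong (λ x → L x j) (sym Sv≡i) ⟩
    L (S v) j        ≡⟨ full-useful-row full u v j ⟩
    bit (lookup v j) ∎
... | no k∉S
  with w , Sw≡i ← covered (redirect S v k)
                    (useful-redirect u (λ j → trans (same j) (cong (λ x → L x j) (sym Sv≡i)))
                                       (λ w → k∉S ∘ (w ,_)))
  = redirect-avoids (proj₁ u) Sv≡i k≢i w Sw≡i

corollary4p9 : (n m : ℕ) → 1 ≤ n → 2 ^ n < m →
    ((L : Matrix m n) → Reachable L → (i : Fin m) → ¬ Essential L i →
      (j : Fin n) → ¬ (L i j ≡ bit true))
    × ((L : Matrix m n) → Reachable L → Full L → (i : Fin m) → ¬ Essential L i →
      (j : Fin n) → L i j ≡ bit false)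
    × ((L : Matrix m n) → Reachable L → Full L → (i : Fin m) →
      ¬ ((j : Fin n) → L i j ≡ bit false) →
      Essential L i × ((k : Fin m) → ¬ (k ≡ i) → ∃ λ j → ¬ (L k j ≡ L i j)))
corollary4p9 n m _ 2ⁿ<m = no-1-outside-essential , zero-outside-essential , nonzero-essential
  where
  invariant : ∀ {L : Matrix m n} → Reachable L → ZeroFirstInvariant L
  invariant = reachable-invariant (<⇒≤ 2ⁿ<m)

  no-1-outside-essential : (L : Matrix m n) → Reachable L → (i : Fin m) → ¬ Essential L i →
                           (j : Fin n) → ¬ (L i j ≡ bit true)
  no-1-outside-essential L r i ¬essential j Lᵢⱼ≡1 =
    not-blocked (invariant r) λ unblocked →
      ¬essential (unblocked , rows-with-1-covered (invariant r) i j Lᵢⱼ≡1)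

  zero-outside-essential : (L : Matrix m n) → Reachable L → Full L → (i : Fin m) → ¬ Essential L i →
                           (j : Fin n) → L i j ≡ bit false
  zero-outside-essential L r full i ¬essential j =
    known-not-flip false (full i j) (no-1-outside-essential L r i ¬essential j)

  nonzero-essential : (L : Matrix m n) → Reachable L → Full L → (i : Fin m) →
                      ¬ ((j : Fin n) → L i j ≡ bit false) →
                      Essential L i × ((k : Fin m) → ¬ (k ≡ i) → ∃ λ j → ¬ (L k j ≡ L i j))
  nonzero-essential L r full i nonzero = essential , λ k k≢i →
    ¬∀⟶∃¬ n _ (λ j → L k j ≟ᶜ L i j) (essential-row-not-duplicated full essential k≢i)
    where
    essential : Essential L i
    essential with j , Lᵢⱼ≢0 ← ¬∀⟶∃¬ n _ (λ j → L i j ≟ᶜ bit false) nonzero =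
      full-unblocked full (not-blocked (invariant r)) ,
      rows-with-1-covered (invariant r) i j (known-not-flip true (full i j) Lᵢⱼ≢0)
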